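{- Consider the automated trading system (ATS) rewriting system and the set of states $L(\Sigma_{NLC})$ described in the context. For every state $\Delta \in L(\Sigma_{NLC})$ and every ATS rule $\sigma$, if $\Delta \xrightarrow{\sigma} \Delta'$ (i.e. $\Delta'$ is obtained from $\Delta$ by one application of $\sigma$), then $\Delta' \in L(\Sigma_{NLC})$.
   Context: Terms. Natural numbers are unary ($\mathsf{z}$, $\mathsf{s}(\cdot)$). Actions are $\mathsf{buy},\mathsf{sell}$, with $\mathrm{dual}(\mathsf{buy},\mathsf{sell})$ and $\mathrm{dual}(\mathsf{sell},\mathsf{buy})$. Order types are $\mathsf{limit},\mathsf{market},\mathsf{cancel}$. Price lists are lists of naturals ($\mathsf{nil}$, $P::L$). Price queues are $\mathsf{nilP}$ or $\mathsf{consP}(ID,N,T,PQ)$ (an entry with identifier $ID$, quantity $N$, timestamp $T$, followed by queue $PQ$). Order queues are $\mathsf{empty}$ or $\mathsf{front}(o,Q)$ where $o=\mathsf{ordN}(O,A,P,ID,N,T)$ (order type, action, price, identifier, quantity, timestamp). States are finite multisets of linear facts of the forms $\mathsf{begin}$, $\mathsf{order}(O,A,P,ID,N)$, $\mathsf{orderQ}(Q)$, $\mathsf{priceQ}(A,P,PQ)$, $\mathsf{active}(A,L)$, $\mathsf{time}(T)$. A rule has a multiset of consumed facts, side conditions, and a multiset of produced facts; $\Delta\xrightarrow{\sigma}\Delta'$ means that for some instantiation of the rule's variables satisfying the side conditions, the consumed facts form a sub-multiset of $\Delta$, and $\Delta'$ is $\Delta$ with them removed and the produced facts added. Side conditions (not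 consuming facts): $\mathrm{enq}(Q,o,Q')$: $Q'$ is $Q$ with $o$ appended at the end. $\mathrm{store}(\mathsf{buy},L,P)$: every element of $L$ is $>P$; $\mathrm{store}(\mathsf{sell},L,P)$: every element of $L$ is $<P$. $\mathrm{exchange}(\mathsf{buy},L,P,X)$: $L$ nonempty, $X=\min L$ and $X\le P$; $\mathrm{exchange}(\mathsf{sell},L,P,X)$: $L$ nonempty, $X=\max L$ and $X\ge P$. $\mathrm{mktExchange}(\mathsf{buy},L,X)$: $L$ nonempty, $X=\min L$; $\mathrm{mktExchange}(\mathsf{sell},L,X)$: $L$ nonempty, $X=\max L$. $\mathrm{notInList}(L,P)$: $P\notin L$. $\mathrm{ins}(L,P,L')$: $L'$ is $L$ with $P$ inserted. $\mathrm{remove}(L,X,L')$: $L'$ is $L$ with $X$ removed. $\mathrm{ext}(PQ,ID,N,T,PQ')$: $PQ'$ is $PQ$ with entry $(ID,N,T)$ appended at the end. $\mathrm{inListF}(PQ,ID)$ / $\mathrm{notInListF}(PQ,ID)$: $PQ$ does / does not contain an entry with identifier $ID$; $\mathrm{removeF}(PQ,ID,PQ')$: $PQ'$ is $PQ$ with that entry removed. $N''=N-N'$ etc. are ordinary arithmetic. Below, $\mathrm{dual}(A,A')$ is a side condition of every rule mentioning $A'$, and $F_O := \mathsf{orderQ}(\mathsf{front}(\mathsf{ordN}(O,A,P,ID,N,T),Q))$. ATS rules (consumed $\Rightarrow$ produced; [side conditions]): - begin: $\mathsf{begin}\Rightarrow \mathsf{orderQ}(\mathsf{empty}),\mathsf{active}(\mathsf{buy},\mathsf{nil}),\mathsf{active}(\mathsf{sell},\mathsf{nil}),\mathsf{time}(\mathsf{z})$.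 - enqueue: $\mathsf{order}(O,A,P,ID,N),\mathsf{orderQ}(Q),\mathsf{time}(T)\Rightarrow\mathsf{orderQ}(Q'),\mathsf{time}(\mathsf{s}(T))$ [$\mathrm{enq}(Q,\mathsf{ordN}(O,A,P,ID,N,T),Q')$]. - limit/empty: $F_{\mathsf{limit}},\mathsf{active}(A',L'),\mathsf{active}(A,L),\mathsf{time}(T)\Rightarrow \mathsf{orderQ}(Q),\mathsf{active}(A',L'),\mathsf{priceQ}(A,P,\mathsf{consP}(ID,N,T,\mathsf{nilP})),\mathsf{active}(A,LP),\mathsf{time}(\mathsf{s}(T))$ [$\mathrm{store}(A,L',P)$, $\mathrm{notInList}(L,P)$, $\mathrm{ins}(L,P,LP)$]. - limit/queue: $F_{\mathsf{limit}},\mathsf{active}(A',L'),\mathsf{priceQ}(A,P,PQ),\mathsf{time}(T)\Rightarrow\mathsf{orderQ}(Q),\mathsf{active}(A',L'),\mathsf{priceQ}(A,P,PQ'),\mathsf{time}(\mathsf{s}(T))$ [$\mathrm{store}(A,L',P)$, $\mathrm{ext}(PQ,ID,N,T,PQ')$]. - limit/1: $F_{\mathsf{limit}},\mathsf{active}(A',L'),\mathsf{priceQ}(A',X,\mathsf{consP}(ID',N',T',\mathsf{nilP})),\mathsf{time}(T)\Rightarrow\mathsf{orderQ}(Q),\mathsf{active}(A',L''),\mathsf{time}(\mathsf{s}(T))$ [$\mathrm{exchange}(A,L',P,X)$, $\mathrm{remove}(L',X,L'')$, $N=N'$]. - limit/2: $F_{\mathsf{limit}},\mathsf{active}(A',L'),\mathsf{priceQ}(A',X,\mathsf{consP}(ID',N',T',\mathsf{consP}(ID_1,N_1,T_1,L))),\mathsf{time}(T)\Rightarrow\mathsf{orderQ}(Q),\mathsf{active}(A',L'),\mathsf{priceQ}(A',X,\mathsf{consP}(ID_1,N_1,T_1,L)),\mathsf{time}(\mathsf{s}(T))$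 [$\mathrm{exchange}(A,L',P,X)$, $N=N'$]. - limit/3: $F_{\mathsf{limit}},\mathsf{active}(A',L'),\mathsf{priceQ}(A',X,\mathsf{consP}(ID',N',T',\mathsf{nilP}))\Rightarrow\mathsf{orderQ}(\mathsf{front}(\mathsf{ordN}(\mathsf{limit},A,P,ID,N'',T),Q)),\mathsf{active}(A',L'')$ [$\mathrm{exchange}(A,L',P,X)$, $\mathrm{remove}(L',X,L'')$, $N>N'$, $N''=N-N'$]. - limit/4: $F_{\mathsf{limit}},\mathsf{active}(A',L'),\mathsf{priceQ}(A',X,\mathsf{consP}(ID',N',T',\mathsf{consP}(ID_1,N_1,T_1,L)))\Rightarrow\mathsf{orderQ}(\mathsf{front}(\mathsf{ordN}(\mathsf{limit},A,P,ID,N'',T),Q)),\mathsf{active}(A',L'),\mathsf{priceQ}(A',X,\mathsf{consP}(ID_1,N_1,T_1,L))$ [$\mathrm{exchange}(A,L',P,X)$, $N>N'$, $N''=N-N'$]. - limit/5: $F_{\mathsf{limit}},\mathsf{active}(A',L'),\mathsf{priceQ}(A',X,\mathsf{consP}(ID',N',T',L)),\mathsf{time}(T)\Rightarrow\mathsf{orderQ}(Q),\mathsf{active}(A',L'),\mathsf{priceQ}(A',X,\mathsf{consP}(ID',N'',T',L)),\mathsf{time}(\mathsf{s}(T))$ [$\mathrm{exchange}(A,L',P,X)$, $N<N'$, $N''=N'-N$]. - market/empty: $F_{\mathsf{market}},\mathsf{active}(A',\mathsf{nil}),\mathsf{time}(T)\Rightarrow\mathsf{orderQ}(Q),\mathsf{active}(A',\mathsf{nil}),\mathsf{time}(\mathsf{s}(T))$.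 - market/$i$ for $i=1,\dots,5$: identical to limit/$i$ except that the consumed order-queue fact is $F_{\mathsf{market}}$ and the side condition $\mathrm{exchange}(A,L',P,X)$ is replaced by $\mathrm{mktExchange}(A,L',X)$; in market/3 and market/4 the produced order-queue fact is $\mathsf{orderQ}(\mathsf{front}(\mathsf{ordN}(\mathsf{limit},A,P,ID,N'',T),Q))$. - cancel/inListNil: $F_{\mathsf{cancel}},\mathsf{active}(A,L'),\mathsf{priceQ}(A,P,\mathsf{consP}(ID,N,T',\mathsf{nilP})),\mathsf{time}(T)\Rightarrow\mathsf{orderQ}(Q),\mathsf{active}(A,L''),\mathsf{time}(\mathsf{s}(T))$ [$\mathrm{remove}(L',P,L'')$]. - cancel/inListCons: $F_{\mathsf{cancel}},\mathsf{priceQ}(A,P,PQ),\mathsf{time}(T)\Rightarrow\mathsf{orderQ}(Q),\mathsf{priceQ}(A,P,PQ'),\mathsf{time}(\mathsf{s}(T))$ [$\mathrm{inListF}(PQ,ID)$, $\mathrm{removeF}(PQ,ID,PQ')$]. - cancel/notInListQueue: $F_{\mathsf{cancel}},\mathsf{priceQ}(A,P,PQ),\mathsf{time}(T)\Rightarrow\mathsf{orderQ}(Q),\mathsf{priceQ}(A,P,PQ),\mathsf{time}(\mathsf{s}(T))$ [$\mathrm{notInListF}(PQ,ID)$]. - cancel/notInListActive: $F_{\mathsf{cancel}},\mathsf{active}(A,L'),\mathsf{time}(T)\Rightarrow\mathsf{orderQ}(Q),\mathsf{active}(A,L'),\mathsf{time}(\mathsf{s}(T))$ [$\mathrm{notInList}(L',P)$].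 The language $L(\Sigma_{NLC})$ (generated by a generative grammar) is the set of all multisets of the form $\{\mathsf{orderQ}(Q),\mathsf{active}(\mathsf{buy},L_B),\mathsf{active}(\mathsf{sell},L_S),\mathsf{time}(T)\}$ together with, for each entry $P$ of the list $L_B$ (counted with multiplicity), one fact $\mathsf{priceQ}(\mathsf{buy},P,PQ)$ with an arbitrary price queue $PQ$, and for each entry $P$ of $L_S$ one fact $\mathsf{priceQ}(\mathsf{sell},P,PQ)$ with arbitrary $PQ$, where $Q,T,L_B,L_S$ are arbitrary subject to the guard $\max L_B<\min L_S$ (the bid price is strictly below the ask price). -}

module Defs where

open import Data.Nat using (ℕ; zero; suc; _∸_; _≤_; _<_)
open import Data.List using (List; []; _∷_; _++_; map)
open import Data.List.Membership.Propositional using (_∈_)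
open import Data.List.Relation.Unary.All using (All)
open import Data.List.Relation.Binary.Permutation.Propositional using (_↭_)
open import Data.Product using (Σ; ∃; _×_; _,_; proj₁; uncurry)
open import Relation.Binary.PropositionalEquality using (_≡_)
open import Relation.Nullary using (¬_)

data Action : Set where
  buy sell : Action

data Dual : Action → Action → Set where
  dual-bs : Dual buy sell
  dual-sb : Dual sell buy

data OType : Set where
  limit market cancel : OType

-- Price queues: nilP | consP(ID, N, T, PQ)
data PQueue : Set where
  nilP  : PQueue
  consP : ℕ → ℕ → ℕ → PQueue → PQueue

record Ord : Set where
  constructor ordN
  field
    otype  : OType
    action : Action
    price  : ℕ
    ident  : ℕ
    qty    : ℕ
    stamp  : ℕ

data OQueue : Set where
  empty : OQueue
  front : Ord → OQueue → OQueue

-- Facts and states (states are finite multisets = lists up to ↭)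

data Fact : Set where
  begin  : Fact
  order  : OType → Action → ℕ → ℕ → ℕ → Fact
  orderQ : OQueue → Fact
  priceQ : Action → ℕ → PQueue → Fact
  active : Action → List ℕ → Fact
  time   : ℕ → Fact

State : Set
State = List Fact

enqQ : OQueue → Ord → OQueue
enqQ empty       o = front o empty
enqQ (front p q) o = front p (enqQ q o)

Enq : OQueue → Ord → OQueue → Set
Enq Q o Q' = Q' ≡ enqQ Q o

Store : Action → List ℕ → ℕ → Set
Store buy  L P = All (λ x → P < x) L
Store sell L P = All (λ x → x < P) L

IsMin : List ℕ → ℕ → Set
IsMin L X = X ∈ L × All (λ y → X ≤ y) L

IsMax : List ℕ → ℕ → Set
IsMax L X = X ∈ L × All (λ y → y ≤ X) L

Exchange : Action → List ℕ → ℕ → ℕ → Set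
Exchange buy  L P X = IsMin L X × X ≤ P
Exchange sell L P X = IsMax L X × P ≤ X

MktExchange : Action → List ℕ → ℕ → Set
MktExchange buy  L X = IsMin L X
MktExchange sell L X = IsMax L X

NotInList : List ℕ → ℕ → Set
NotInList L P = ¬ (P ∈ L)

Ins : List ℕ → ℕ → List ℕ → Set
Ins L P L' = Σ (List ℕ) λ xs → Σ (List ℕ) λ ys → L ≡ xs ++ ys × L' ≡ xs ++ P ∷ ys

Remove : List ℕ → ℕ → List ℕ → Set
Remove L X L' = Σ (List ℕ) λ xs → Σ (List ℕ) λ ys → L ≡ xs ++ X ∷ ys × L' ≡ xs ++ ys

extP : PQueue → ℕ → ℕ → ℕ → PQueue
extP nilP              i n t = consP i n t nilP
extP (consP j m s pq)  i n t = consP j m s (extP pq i n t)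

Ext : PQueue → ℕ → ℕ → ℕ → PQueue → Set
Ext PQ i n t PQ' = PQ' ≡ extP PQ i n t

data InListF : PQueue → ℕ → Set where
  here  : ∀ {i n t pq} → InListF (consP i n t pq) i
  there : ∀ {i j n t pq} → InListF pq i → InListF (consP j n t pq) i

NotInListF : PQueue → ℕ → Set
NotInListF PQ i = ¬ InListF PQ i

data RemoveF : PQueue → ℕ → PQueue → Set where
  here  : ∀ {i n t pq} → RemoveF (consP i n t pq) i pq
  there : ∀ {i j n t pq pq'} → RemoveF pq i pq' → RemoveF (consP j n t pq) i (consP j n t pq')

data Rule : Set where
  r-begin r-enqueue : Rule
  r-limit-empty r-limit-queue r-limit1 r-limit2 r-limit3 r-limit4 r-limit5 : Rule
  r-market-empty r-market1 r-market2 r-market3 r-market4 r-market5 : Rule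
  r-cancel-inListNil r-cancel-inListCons r-cancel-notInListQueue r-cancel-notInListActive : Rule

F : OType → Action → ℕ → ℕ → ℕ → ℕ → OQueue → Fact
F O A P ID N T Q = orderQ (front (ordN O A P ID N T) Q)

-- Inst σ consumed produced : an instance of rule σ satisfying its side conditions
data Inst : Rule → List Fact → List Fact → Set where
  begin : Inst r-begin (begin ∷ [])
    (orderQ empty ∷ active buy [] ∷ active sell [] ∷ time zero ∷ [])

  enqueue : ∀ O A P ID N Q T Q' → Enq Q (ordN O A P ID N T) Q' →
    Inst r-enqueue (order O A P ID N ∷ orderQ Q ∷ time T ∷ [])
                   (orderQ Q' ∷ time (suc T) ∷ [])

  limit-empty : ∀ A A' P ID N T Q L' L LP →
    Dual A A' → Store A L' P → NotInList L P → Ins L P LP →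
    Inst r-limit-empty
      (F limit A P ID N T Q ∷ active A' L' ∷ active A L ∷ time T ∷ [])
      (orderQ Q ∷ active A' L' ∷ priceQ A P (consP ID N T nilP) ∷ active A LP ∷ time (suc T) ∷ [])

  limit-queue : ∀ A A' P ID N T Q L' PQ PQ' →
    Dual A A' → Store A L' P → Ext PQ ID N T PQ' →
    Inst r-limit-queue
      (F limit A P ID N T Q ∷ active A' L' ∷ priceQ A P PQ ∷ time T ∷ [])
      (orderQ Q ∷ active A' L' ∷ priceQ A P PQ' ∷ time (suc T) ∷ [])

  limit1 : ∀ A A' P ID N T Q L' L'' X ID' N' T' →
    Dual A A' → Exchange A L' P X → Remove L' X L'' → N ≡ N' →
    Inst r-limit1
      (F limit A P ID N T Q ∷ active A' L' ∷ priceQ A' X (consP ID' N' T' nilP) ∷ time T ∷ [])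
      (orderQ Q ∷ active A' L'' ∷ time (suc T) ∷ [])

  limit2 : ∀ A A' P ID N T Q L' X ID' N' T' ID₁ N₁ T₁ L →
    Dual A A' → Exchange A L' P X → N ≡ N' →
    Inst r-limit2
      (F limit A P ID N T Q ∷ active A' L' ∷ priceQ A' X (consP ID' N' T' (consP ID₁ N₁ T₁ L)) ∷ time T ∷ [])
      (orderQ Q ∷ active A' L' ∷ priceQ A' X (consP ID₁ N₁ T₁ L) ∷ time (suc T) ∷ [])

  limit3 : ∀ A A' P ID N T Q L' L'' X ID' N' T' N'' →
    Dual A A' → Exchange A L' P X → Remove L' X L'' → N' < N → N'' ≡ N ∸ N' →
    Inst r-limit3
      (F limit A P ID N T Q ∷ active A' L' ∷ priceQ A' X (consP ID' N' T' nilP) ∷ [])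
      (orderQ (front (ordN limit A P ID N'' T) Q) ∷ active A' L'' ∷ [])

  limit4 : ∀ A A' P ID N T Q L' X ID' N' T' ID₁ N₁ T₁ L N'' →
    Dual A A' → Exchange A L' P X → N' < N → N'' ≡ N ∸ N' →
    Inst r-limit4
      (F limit A P ID N T Q ∷ active A' L' ∷ priceQ A' X (consP ID' N' T' (consP ID₁ N₁ T₁ L)) ∷ [])
      (orderQ (front (ordN limit A P ID N'' T) Q) ∷ active A' L' ∷ priceQ A' X (consP ID₁ N₁ T₁ L) ∷ [])

  limit5 : ∀ A A' P ID N T Q L' X ID' N' T' L N'' →
    Dual A A' → Exchange A L' P X → N < N' → N'' ≡ N' ∸ N →
    Inst r-limit5
      (F limit A P ID N T Q ∷ active A' L' ∷ priceQ A' X (consP ID' N' T' L) ∷ time T ∷ [])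
      (orderQ Q ∷ active A' L' ∷ priceQ A' X (consP ID' N'' T' L) ∷ time (suc T) ∷ [])

  market-empty : ∀ A A' P ID N T Q →
    Dual A A' →
    Inst r-market-empty
      (F market A P ID N T Q ∷ active A' [] ∷ time T ∷ [])
      (orderQ Q ∷ active A' [] ∷ time (suc T) ∷ [])

  market1 : ∀ A A' P ID N T Q L' L'' X ID' N' T' →
    Dual A A' → MktExchange A L' X → Remove L' X L'' → N ≡ N' →
    Inst r-market1
      (F market A P ID N T Q ∷ active A' L' ∷ priceQ A' X (consP ID' N' T' nilP) ∷ time T ∷ [])
      (orderQ Q ∷ active A' L'' ∷ time (suc T) ∷ [])

  market2 : ∀ A A' P ID N T Q L' X ID' N' T' ID₁ N₁ T₁ L →
    Dual A A' → MktExchange A L' X → N ≡ N' →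
    Inst r-market2
      (F market A P ID N T Q ∷ active A' L' ∷ priceQ A' X (consP ID' N' T' (consP ID₁ N₁ T₁ L)) ∷ time T ∷ [])
      (orderQ Q ∷ active A' L' ∷ priceQ A' X (consP ID₁ N₁ T₁ L) ∷ time (suc T) ∷ [])

  market3 : ∀ A A' P ID N T Q L' L'' X ID' N' T' N'' →
    Dual A A' → MktExchange A L' X → Remove L' X L'' → N' < N → N'' ≡ N ∸ N' →
    Inst r-market3
      (F market A P ID N T Q ∷ active A' L' ∷ priceQ A' X (consP ID' N' T' nilP) ∷ [])
      (orderQ (front (ordN limit A P ID N'' T) Q) ∷ active A' L'' ∷ [])

  market4 : ∀ A A' P ID N T Q L' X ID' N' T' ID₁ N₁ T₁ L N'' →
    Dual A A' → MktExchange A L' X → N' < N → N'' ≡ N ∸ N' →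
    Inst r-market4
      (F market A P ID N T Q ∷ active A' L' ∷ priceQ A' X (consP ID' N' T' (consP ID₁ N₁ T₁ L)) ∷ [])
      (orderQ (front (ordN limit A P ID N'' T) Q) ∷ active A' L' ∷ priceQ A' X (consP ID₁ N₁ T₁ L) ∷ [])

  market5 : ∀ A A' P ID N T Q L' X ID' N' T' L N'' →
    Dual A A' → MktExchange A L' X → N < N' → N'' ≡ N' ∸ N →
    Inst r-market5
      (F market A P ID N T Q ∷ active A' L' ∷ priceQ A' X (consP ID' N' T' L) ∷ time T ∷ [])
      (orderQ Q ∷ active A' L' ∷ priceQ A' X (consP ID' N'' T' L) ∷ time (suc T) ∷ [])

  cancel-inListNil : ∀ A P ID N T Q L' L'' T' →
    Remove L' P L'' →
    Inst r-cancel-inListNil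
      (F cancel A P ID N T Q ∷ active A L' ∷ priceQ A P (consP ID N T' nilP) ∷ time T ∷ [])
      (orderQ Q ∷ active A L'' ∷ time (suc T) ∷ [])

  cancel-inListCons : ∀ A P ID N T Q PQ PQ' →
    InListF PQ ID → RemoveF PQ ID PQ' →
    Inst r-cancel-inListCons
      (F cancel A P ID N T Q ∷ priceQ A P PQ ∷ time T ∷ [])
      (orderQ Q ∷ priceQ A P PQ' ∷ time (suc T) ∷ [])

  cancel-notInListQueue : ∀ A P ID N T Q PQ →
    NotInListF PQ ID →
    Inst r-cancel-notInListQueue
      (F cancel A P ID N T Q ∷ priceQ A P PQ ∷ time T ∷ [])
      (orderQ Q ∷ priceQ A P PQ ∷ time (suc T) ∷ [])

  cancel-notInListActive : ∀ A P ID N T Q L' →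
    NotInList L' P →
    Inst r-cancel-notInListActive
      (F cancel A P ID N T Q ∷ active A L' ∷ time T ∷ [])
      (orderQ Q ∷ active A L' ∷ time (suc T) ∷ [])

_—[_]→_ : State → Rule → State → Set
Δ —[ σ ]→ Δ' =
  Σ (List Fact) λ cons → Σ (List Fact) λ prod → Σ (List Fact) λ rest →
    Inst σ cons prod × Δ ↭ cons ++ rest × Δ' ↭ prod ++ rest

-- guard "max L_B < min L_S": every bid price is below every ask price
Guard : List ℕ → List ℕ → Set
Guard LB LS = All (λ b → All (λ s → b < s) LS) LB

InNLC : State → Set
InNLC Δ =
  Σ OQueue λ Q → Σ ℕ λ T →
  Σ (List (ℕ × PQueue)) λ bs → Σ (List (ℕ × PQueue)) λ ss →
    Guard (map proj₁ bs) (map proj₁ ss) ×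
    Δ ↭ (orderQ Q ∷ active buy (map proj₁ bs) ∷ active sell (map proj₁ ss) ∷ time T ∷
         (map (uncurry (priceQ buy)) bs ++ map (uncurry (priceQ sell)) ss))

{-# OPTIONS --safe #-}

-- Membership in L(Σ_NLC) depends on a state only through the shapes of its facts
-- (the kind of each fact, plus side and price for active and priceQ facts): a state
-- is in the language iff its shapes are a permutation of the skeleton of a book of
-- bid and ask lists separated by the guard. Such a state has no begin or order
-- fact, and every other rule either keeps the shapes, withdraws a price level (an
-- active list loses X together with the priceQ fact at X) or posts one (an active
-- list gains P together with a priceQ fact at P, the store condition keeping P on
-- its side of the spread). Each move turns the skeleton of a separated book into
-- the skeleton of another separated book.
module Submission where

open import Defs
open import Data.Empty using (⊥-elim)
open import Data.List using (List; []; _∷_; _++_; map)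
open import Data.List.Properties using (map-++; map-∘)
open import Data.List.Membership.Propositional using (_∈_; _∉_)
open import Data.List.Membership.Propositional.Properties using (∈-map⁻; ∈-++⁻; ∈-++⁺ˡ)
open import Data.List.Relation.Unary.All as All using ([]; _∷_)
open import Data.List.Relation.Unary.Any using (here; there)
open import Data.List.Relation.Binary.Pointwise using (Pointwise; []; _∷_)
open import Data.List.Relation.Binary.Permutation.Propositional
  using (_↭_; ↭-refl; ↭-sym; ↭-trans; ↭-reflexive; ↭-prep; ↭-swap)
open import Data.List.Relation.Binary.Permutation.Propositional.Properties
  using (map⁺; ↭-map-inv; ++⁺ˡ; ++⁺ʳ; ++-comm; shift; shifts; drop-∷; ∈-resp-↭; All-resp-↭)
open import Data.Nat using (ℕ)
open import Data.Product using (∃; ∃₂; _×_; _,_; proj₁; proj₂; uncurry)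
open import Data.Sum using (inj₁; inj₂)
open import Relation.Binary.PropositionalEquality using (_≡_; refl; sym; trans; cong; cong₂; subst)

Pointwise-++⁻ : ∀ {A B : Set} {R : A → B → Set} ws {ys xs} → Pointwise R (ws ++ ys) xs →
  ∃₂ λ xs₁ xs₂ → xs ≡ xs₁ ++ xs₂ × Pointwise R ws xs₁ × Pointwise R ys xs₂
Pointwise-++⁻ []       r       = [] , _ , refl , [] , r
Pointwise-++⁻ (w ∷ ws) (r ∷ rs) with xs₁ , xs₂ , refl , r₁ , r₂ ← Pointwise-++⁻ ws rs =
  _ ∷ xs₁ , xs₂ , refl , r ∷ r₁ , r₂

++-cancelˡ-↭ : ∀ {A : Set} (xs : List A) {ys zs} → xs ++ ys ↭ xs ++ zs → ys ↭ zs
++-cancelˡ-↭ []       p = p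
++-cancelˡ-↭ (x ∷ xs) p = ++-cancelˡ-↭ xs (drop-∷ p)

Remove⇒↭ : ∀ {L X L′} → Remove L X L′ → L ↭ X ∷ L′
Remove⇒↭ {X = X} (xs , ys , refl , refl) = shift X xs ys

Ins⇒↭ : ∀ {L P L′} → Ins L P L′ → L′ ↭ P ∷ L
Ins⇒↭ {P = P} (xs , ys , refl , refl) = shift P xs ys

data Shape : Set where
  request queue clock : Shape
  activeS : Action → List ℕ → Shape
  priceS  : Action → ℕ → Shape

shape : Fact → Shape
shape begin               = request
shape (order _ _ _ _ _)   = request
shape (orderQ _)          = queue
shape (priceQ a p _)      = priceS a p
shape (active a L)        = activeS a L
shape (time _)            = clock

data Fiber : Shape → Fact → Set where
  begin  : Fiber request begin
  order  : ∀ {O A P ID N} → Fiber request (order O A P ID N)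
  orderQ : ∀ Q → Fiber queue (orderQ Q)
  priceQ : ∀ {a p} q → Fiber (priceS a p) (priceQ a p q)
  active : ∀ {a L} → Fiber (activeS a L) (active a L)
  time   : ∀ T → Fiber clock (time T)

fiber : ∀ x → Fiber (shape x) x
fiber begin             = begin
fiber (order _ _ _ _ _) = order
fiber (orderQ Q)        = orderQ Q
fiber (priceQ _ _ q)    = priceQ q
fiber (active _ _)      = active
fiber (time T)          = time T

fibers : ∀ Δ → Pointwise Fiber (map shape Δ) Δ
fibers []      = []
fibers (x ∷ Δ) = fiber x ∷ fibers Δ

Book : Set
Book = List ℕ × List ℕ

prices : Action → Book → List ℕ
prices buy  = proj₁
prices sell = proj₂

withPrices : Action → List ℕ → Book → Book
withPrices buy  L (_  , LS) = L , LS
withPrices sell L (LB , _)  = LB , L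

withPrices-prices : ∀ a B → withPrices a (prices a B) B ≡ B
withPrices-prices buy  _ = refl
withPrices-prices sell _ = refl

Separated : Book → Set
Separated (LB , LS) = Guard LB LS

skeleton : Book → List Shape
skeleton (LB , LS) =
  queue ∷ activeS buy LB ∷ activeS sell LS ∷ clock ∷ map (priceS buy) LB ++ map (priceS sell) LS

NLCShaped : List Shape → Set
NLCShaped S = ∃ λ B → S ↭ skeleton B × Separated B

NLCShaped-resp-↭ : ∀ {S S′} → S ↭ S′ → NLCShaped S′ → NLCShaped S
NLCShaped-resp-↭ p (B , q , g) = B , ↭-trans p q , g

shape-priceQs : ∀ a ps → map shape (map (uncurry (priceQ a)) ps) ≡ map (priceS a) (map proj₁ ps)
shape-priceQs a ps = trans (sym (map-∘ ps)) (map-∘ ps)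

shape-books : ∀ bs ss →
  map shape (map (uncurry (priceQ buy)) bs ++ map (uncurry (priceQ sell)) ss)
  ≡ map (priceS buy) (map proj₁ bs) ++ map (priceS sell) (map proj₁ ss)
shape-books bs ss = trans (map-++ shape (map (uncurry (priceQ buy)) bs) (map (uncurry (priceQ sell)) ss))
                          (cong₂ _++_ (shape-priceQs buy bs) (shape-priceQs sell ss))

InNLC⇒NLCShaped : ∀ {Δ} → InNLC Δ → NLCShaped (map shape Δ)
InNLC⇒NLCShaped (Q , T , bs , ss , g , p) =
  (LB , LS) , ↭-trans (map⁺ shape p) (↭-reflexive (cong (λ S → queue ∷ activeS buy LB ∷ activeS sell LS ∷ clock ∷ S)
                                                         (shape-books bs ss))) , g
  where
  LB LS : List ℕ
  LB = map proj₁ bs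
  LS = map proj₁ ss

price-fibers : ∀ {a L Δ} → Pointwise Fiber (map (priceS a) L) Δ →
  ∃ λ ps → Δ ≡ map (uncurry (priceQ a)) ps × map proj₁ ps ≡ L
price-fibers {L = []}    []              = [] , refl , refl
price-fibers {L = p ∷ _} (priceQ q ∷ fs) with ps , refl , refl ← price-fibers fs = (p , q) ∷ ps , refl , refl

skeleton-fibers⇒InNLC : ∀ {LB LS Δ} → Pointwise Fiber (skeleton (LB , LS)) Δ → Guard LB LS → InNLC Δ
skeleton-fibers⇒InNLC {LB} (orderQ Q ∷ active ∷ active ∷ time T ∷ fs) g
  with _ , _ , refl , fsB , fsS ← Pointwise-++⁻ (map (priceS buy) LB) fs
  with bs , refl , refl ← price-fibers fsB
  with ss , refl , refl ← price-fibers fsS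
  = Q , T , bs , ss , g , ↭-refl

NLCShaped⇒InNLC : ∀ {Δ} → NLCShaped (map shape Δ) → InNLC Δ
NLCShaped⇒InNLC {Δ} (B , p , g) with Δ₀ , eq , Δ↭Δ₀ ← ↭-map-inv shape p
  with Q , T , bs , ss , g′ , Δ₀↭ ←
         skeleton-fibers⇒InNLC (subst (λ S → Pointwise Fiber S Δ₀) (sym eq) (fibers Δ₀)) g
  = Q , T , bs , ss , g′ , ↭-trans Δ↭Δ₀ Δ₀↭

∈-priceShapes : ∀ {s} LB LS → s ∈ map (priceS buy) LB ++ map (priceS sell) LS → ∃₂ λ a p → s ≡ priceS a p
∈-priceShapes LB LS s∈ with ∈-++⁻ (map (priceS buy) LB) s∈
... | inj₁ s∈B = let p , _ , eq = ∈-map⁻ (priceS buy) s∈B in buy , p , eq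
... | inj₂ s∈S = let p , _ , eq = ∈-map⁻ (priceS sell) s∈S in sell , p , eq

request∉skeleton : ∀ B → request ∉ skeleton B
request∉skeleton _        (here ())
request∉skeleton _        (there (here ()))
request∉skeleton _        (there (there (here ())))
request∉skeleton _        (there (there (there (here ()))))
request∉skeleton (LB , LS) (there (there (there (there r)))) with ∈-priceShapes LB LS r
... | _ , _ , ()

activeS∈skeleton⇒ : ∀ {a L} B → activeS a L ∈ skeleton B → L ≡ prices a B
activeS∈skeleton⇒         _        (here ())
activeS∈skeleton⇒ {buy}  _        (there (here refl))                = refl
activeS∈skeleton⇒ {sell} _        (there (here ()))
activeS∈skeleton⇒ {buy}  _        (there (there (here ())))
activeS∈skeleton⇒ {sell} _        (there (there (here refl)))        = refl
activeS∈skeleton⇒         _        (there (there (there (here ()))))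
activeS∈skeleton⇒         (LB , LS) (there (there (there (there r)))) with ∈-priceShapes LB LS r
... | _ , _ , ()

request∉NLCShaped : ∀ {S} → NLCShaped S → request ∉ S
request∉NLCShaped (B , p , _) r = request∉skeleton B (∈-resp-↭ p r)

skeleton-focus : ∀ a B → ∃ λ Z → ∀ L → skeleton (withPrices a L B) ↭ queue ∷ activeS a L ∷ map (priceS a) L ++ Z
skeleton-focus buy (_ , LS) =
  _ , λ L → ↭-prep queue (↭-prep _ (shifts (activeS sell LS ∷ clock ∷ []) (map (priceS buy) L)))
skeleton-focus sell (LB , _) =
  _ , λ L → ↭-prep queue (↭-trans (↭-swap _ _ ↭-refl)
              (↭-prep _ (++-comm (activeS buy LB ∷ clock ∷ map (priceS buy) LB) (map (priceS sell) L))))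

skeleton-update : ∀ a B L {S S′} →
  queue ∷ activeS a (prices a B) ∷ S ↭ skeleton B →
  -- S′ is S with the price shapes of side a changed from those of the book to those of L
  map (priceS a) (prices a B) ++ S′ ↭ map (priceS a) L ++ S →
  queue ∷ activeS a L ∷ S′ ↭ skeleton (withPrices a L B)
skeleton-update a B L {S} {S′} p q = ↭-trans (↭-prep queue (↭-prep _ S′↭)) (↭-sym (focus L))
  where
  old new Z : List Shape
  old = map (priceS a) (prices a B)
  new = map (priceS a) L
  Z   = proj₁ (skeleton-focus a B)

  focus : ∀ L′ → skeleton (withPrices a L′ B) ↭ queue ∷ activeS a L′ ∷ map (priceS a) L′ ++ Z
  focus = proj₂ (skeleton-focus a B)

  current : skeleton B ↭ queue ∷ activeS a (prices a B) ∷ old ++ Z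
  current = subst (λ B′ → skeleton B′ ↭ queue ∷ activeS a (prices a B) ∷ old ++ Z)
                  (withPrices-prices a B) (focus (prices a B))

  S↭ : S ↭ old ++ Z
  S↭ = drop-∷ (drop-∷ (↭-trans p current))

  S′↭ : S′ ↭ new ++ Z
  S′↭ = ++-cancelˡ-↭ old (↭-trans q (↭-trans (++⁺ˡ new S↭) (shifts new old)))

Separated-remove : ∀ a {B X L} → prices a B ↭ X ∷ L → Separated B → Separated (withPrices a L B)
Separated-remove buy  p g = All.tail (All-resp-↭ p g)
Separated-remove sell p g = All.map (λ h → All.tail (All-resp-↭ p h)) g

Separated-insert : ∀ {a b B P L} → Dual a b → Store a (prices b B) P → L ↭ P ∷ prices a B →
  Separated B → Separated (withPrices a L B)
Separated-insert dual-bs s p g = All-resp-↭ (↭-sym p) (s ∷ g)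
Separated-insert dual-sb s p g = All.zipWith (λ (b<P , h) → All-resp-↭ (↭-sym p) (b<P ∷ h)) (s , g)

data Effect : List Shape → List Shape → Set where
  keep     : ∀ {S} → Effect S S
  withdraw : ∀ {a L X L′ C} → Remove L X L′ →
    Effect (queue ∷ activeS a L ∷ priceS a X ∷ C) (queue ∷ activeS a L′ ∷ C)
  post     : ∀ {a b Lb L P L′ C} → Dual a b → Store a Lb P → Ins L P L′ →
    Effect (queue ∷ activeS b Lb ∷ activeS a L ∷ C)
           (queue ∷ activeS b Lb ∷ priceS a P ∷ activeS a L′ ∷ C)

Effect-preserves : ∀ {S S′} → Effect S S′ → ∀ R → NLCShaped (S ++ R) → NLCShaped (S′ ++ R)
Effect-preserves keep _ h = h
Effect-preserves (withdraw {a} {X = X} {L′} {C} rm) R (B , p , g)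
  with refl ← activeS∈skeleton⇒ B (∈-resp-↭ p (there (here refl))) =
  withPrices a L′ B , skeleton-update a B L′ p rearrange , Separated-remove a (Remove⇒↭ rm) g
  where
  rearrange : map (priceS a) (prices a B) ++ C ++ R ↭ map (priceS a) L′ ++ priceS a X ∷ C ++ R
  rearrange = ↭-trans (++⁺ʳ (C ++ R) (map⁺ (priceS a) (Remove⇒↭ rm)))
                      (↭-sym (shift (priceS a X) (map (priceS a) L′) (C ++ R)))
Effect-preserves (post {a} {b} {Lb} {P = P} {L′} {C} d s ins) R (B , p , g)
  with refl ← activeS∈skeleton⇒ B (∈-resp-↭ p (there (here refl)))
     | refl ← activeS∈skeleton⇒ B (∈-resp-↭ p (there (there (here refl)))) =
  withPrices a L′ B , ↭-trans reorder (skeleton-update a B L′ (↭-trans swap-actives p) rearrange)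
                    , Separated-insert d s (Ins⇒↭ ins) g
  where
  W : List Shape
  W = activeS b Lb ∷ C ++ R

  swap-actives : queue ∷ activeS a (prices a B) ∷ W ↭ queue ∷ activeS b Lb ∷ activeS a (prices a B) ∷ C ++ R
  swap-actives = ↭-prep queue (↭-swap _ _ ↭-refl)

  rearrange : map (priceS a) (prices a B) ++ priceS a P ∷ W ↭ map (priceS a) L′ ++ W
  rearrange = ↭-trans (shift (priceS a P) (map (priceS a) (prices a B)) W)
                      (++⁺ʳ W (↭-sym (map⁺ (priceS a) (Ins⇒↭ ins))))

  reorder : queue ∷ activeS b Lb ∷ priceS a P ∷ activeS a L′ ∷ C ++ R ↭ queue ∷ activeS a L′ ∷ priceS a P ∷ W
  reorder = ↭-prep queue (↭-trans (↭-swap _ _ ↭-refl) (↭-trans (↭-prep _ (↭-swap _ _ ↭-refl)) (↭-swap _ _ ↭-refl)))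

effect : ∀ {σ cons prod} → Inst σ cons prod → request ∉ map shape cons → Effect (map shape cons) (map shape prod)
effect begin                                                   noRequest = ⊥-elim (noRequest (here refl))
effect (enqueue _ _ _ _ _ _ _ _ _)                             noRequest = ⊥-elim (noRequest (here refl))
effect (limit-empty _ _ _ _ _ _ _ _ _ _ d s _ ins)             _ = post d s ins
effect (limit-queue _ _ _ _ _ _ _ _ _ _ _ _ _)                 _ = keep
effect (limit1 _ _ _ _ _ _ _ _ _ _ _ _ _ _ _ rm _)             _ = withdraw rm
effect (limit2 _ _ _ _ _ _ _ _ _ _ _ _ _ _ _ _ _ _ _)          _ = keep
effect (limit3 _ _ _ _ _ _ _ _ _ _ _ _ _ _ _ _ rm _ _)         _ = withdraw rm
effect (limit4 _ _ _ _ _ _ _ _ _ _ _ _ _ _ _ _ _ _ _ _ _)      _ = keep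
effect (limit5 _ _ _ _ _ _ _ _ _ _ _ _ _ _ _ _ _ _)            _ = keep
effect (market-empty _ _ _ _ _ _ _ _)                          _ = keep
effect (market1 _ _ _ _ _ _ _ _ _ _ _ _ _ _ _ rm _)            _ = withdraw rm
effect (market2 _ _ _ _ _ _ _ _ _ _ _ _ _ _ _ _ _ _ _)         _ = keep
effect (market3 _ _ _ _ _ _ _ _ _ _ _ _ _ _ _ _ rm _ _)        _ = withdraw rm
effect (market4 _ _ _ _ _ _ _ _ _ _ _ _ _ _ _ _ _ _ _ _ _)     _ = keep
effect (market5 _ _ _ _ _ _ _ _ _ _ _ _ _ _ _ _ _ _)           _ = keep
effect (cancel-inListNil _ _ _ _ _ _ _ _ _ rm)                 _ = withdraw rm
effect (cancel-inListCons _ _ _ _ _ _ _ _ _ _)                 _ = keep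
effect (cancel-notInListQueue _ _ _ _ _ _ _ _)                 _ = keep
effect (cancel-notInListActive _ _ _ _ _ _ _ _)                _ = keep

shape-↭-++ : ∀ {Δ} xs {ys} → Δ ↭ xs ++ ys → map shape Δ ↭ map shape xs ++ map shape ys
shape-↭-++ xs {ys} p = ↭-trans (map⁺ shape p) (↭-reflexive (map-++ shape xs ys))

theorem1 : (σ : Rule) (Δ Δ' : State) → InNLC Δ → Δ —[ σ ]→ Δ' → InNLC Δ'
theorem1 σ Δ Δ' Δ∈ (cons , prod , rest , inst , Δ↭ , Δ'↭) =
  NLCShaped⇒InNLC (NLCShaped-resp-↭ (shape-↭-++ prod Δ'↭)
    (Effect-preserves (effect inst noRequest) (map shape rest) before))
  where
  before : NLCShaped (map shape cons ++ map shape rest)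
  before = NLCShaped-resp-↭ (↭-sym (shape-↭-++ cons Δ↭)) (InNLC⇒NLCShaped Δ∈)

  noRequest : request ∉ map shape cons
  noRequest r = request∉NLCShaped before (∈-++⁺ˡ r)
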